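{- Let $S$ be a Hilbert-style proof system for the implicational propositional language whose only inference rule is modus ponens and whose axioms include all instances of the schemes $A \supset (B \supset A)$ and $[A \supset (B \supset C)] \supset [(A \supset B) \supset (A \supset C)]$ (and possibly instances of further axiom schemes). Then every instance of the Peirce scheme $[(A \supset B) \supset A] \supset A$ is a theorem of $S$ if and only if every instance of the scheme $(A \supset Q) \supset \{ [ (A \supset B) \supset Q] \supset Q \}$ is a theorem of $S$ (where $A, B, Q$ range over all well-formed formulas).
   Context: The implicational propositional language has propositional variables and the single binary connective $\supset$ (the conditional); well-formed formulas are built from variables using $\supset$. A theorem of $S$ is a formula deducible in $S$ from no hypotheses; $\Gamma \vdash B$ means $B$ is deducible in $S$ from the set of hypotheses $\Gamma$ using the axioms of $S$ and modus ponens (from $A$ and $A \supset B$ infer $B$). -}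

module Defs where

open import Data.Nat using (ℕ)
open import Level using (Level; suc; _⊔_)

data Formula : Set where
  var  : ℕ → Formula
  _⊃_  : Formula → Formula → Formula

infixr 5 _⊃_

-- A Hilbert-style system S is determined by its set of axioms.
-- Its axioms include all instances of K and S and possibly further
-- axioms, given by an arbitrary predicate Extra.
data Axiom {ℓ : Level} (Extra : Formula → Set ℓ) : Formula → Set ℓ where
  axK     : ∀ A B → Axiom Extra (A ⊃ (B ⊃ A))
  axS     : ∀ A B C → Axiom Extra ((A ⊃ (B ⊃ C)) ⊃ ((A ⊃ B) ⊃ (A ⊃ C)))
  axExtra : ∀ {A} → Extra A → Axiom Extra A

data _⊢[_]_ {ℓ ℓ' : Level} (Γ : Formula → Set ℓ') (Extra : Formula → Set ℓ) : Formula → Set (ℓ ⊔ ℓ') where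
  hyp : ∀ {A} → Γ A → Γ ⊢[ Extra ] A
  ax  : ∀ {A} → Axiom Extra A → Γ ⊢[ Extra ] A
  mp  : ∀ {A B} → Γ ⊢[ Extra ] A → Γ ⊢[ Extra ] (A ⊃ B) → Γ ⊢[ Extra ] B

data ∅ : Formula → Set where

Theorem : {ℓ : Level} → (Formula → Set ℓ) → Formula → Set ℓ
Theorem Extra A = ∅ ⊢[ Extra ] A

PeirceHolds : {ℓ : Level} → (Formula → Set ℓ) → Set ℓ
PeirceHolds Extra = ∀ A B → Theorem Extra (((A ⊃ B) ⊃ A) ⊃ A)

SchemeHolds : {ℓ : Level} → (Formula → Set ℓ) → Set ℓ
SchemeHolds Extra = ∀ A B Q → Theorem Extra ((A ⊃ Q) ⊃ (((A ⊃ B) ⊃ Q) ⊃ Q))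

-- Peirce's law at Q and B, ((Q ⊃ B) ⊃ Q) ⊃ Q, yields the scheme: from A ⊃ Q and
-- (A ⊃ B) ⊃ Q one gets (Q ⊃ B) ⊃ Q, since Q ⊃ B composed with A ⊃ Q gives A ⊃ B.
-- Conversely, the scheme at Q := A is (A ⊃ A) ⊃ Peirce, and A ⊃ A is provable from K and S.
module Submission where

open import Defs
open import Level using (Level)
open import Data.Product using (_×_; _,_)
open import Data.Sum using (_⊎_; inj₁; inj₂)
open import Relation.Binary.PropositionalEquality using (_≡_; refl)

private
  variable
    ℓ ℓ' ℓ'' : Level
    Extra : Formula → Set ℓ
    A B C : Formula

infixl 4 _▸_

_▸_ : (Formula → Set ℓ') → Formula → Formula → Set ℓ'
(Γ ▸ A) X = Γ X ⊎ X ≡ A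

module _ {Γ : Formula → Set ℓ'} where

  ⊢-refl : Γ ⊢[ Extra ] (A ⊃ A)
  ⊢-refl {A = A} = mp (ax (axK A A)) (mp (ax (axK A (A ⊃ A))) (ax (axS A (A ⊃ A) A)))

  deduction : (Γ ▸ A) ⊢[ Extra ] B → Γ ⊢[ Extra ] (A ⊃ B)
  deduction {A = A} (hyp (inj₁ γ))    = mp (hyp γ) (ax (axK _ A))
  deduction         (hyp (inj₂ refl)) = ⊢-refl
  deduction {A = A} (ax α)            = mp (ax α) (ax (axK _ A))
  deduction {A = A} (mp p q)          = mp (deduction p) (mp (deduction q) (ax (axS A _ _)))

  ⊢-mono : {Δ : Formula → Set ℓ''} → (∀ {X} → Γ X → Δ X) →
           Γ ⊢[ Extra ] A → Δ ⊢[ Extra ] A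
  ⊢-mono Γ⊆Δ (hyp γ)  = hyp (Γ⊆Δ γ)
  ⊢-mono Γ⊆Δ (ax α)   = ax α
  ⊢-mono Γ⊆Δ (mp p q) = mp (⊢-mono Γ⊆Δ p) (⊢-mono Γ⊆Δ q)

  ⊢-trans : Γ ⊢[ Extra ] (A ⊃ B) → Γ ⊢[ Extra ] (B ⊃ C) → Γ ⊢[ Extra ] (A ⊃ C)
  ⊢-trans A⊃B B⊃C =
    deduction (mp (mp (hyp (inj₂ refl)) (⊢-mono inj₁ A⊃B)) (⊢-mono inj₁ B⊃C))

theorem-weaken : {Γ : Formula → Set ℓ'} → Theorem Extra A → Γ ⊢[ Extra ] A
theorem-weaken = ⊢-mono λ ()

peirce⇒scheme : PeirceHolds Extra → SchemeHolds Extra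
peirce⇒scheme peirce A B Q =
  deduction (deduction (mp (deduction Q-under-Q⊃B) (theorem-weaken (peirce Q B))))
  where
  Q-under-Q⊃B : (∅ ▸ A ⊃ Q ▸ (A ⊃ B) ⊃ Q ▸ Q ⊃ B) ⊢[ _ ] Q
  Q-under-Q⊃B = mp (⊢-trans (hyp (inj₁ (inj₁ (inj₂ refl)))) (hyp (inj₂ refl)))
                (hyp (inj₁ (inj₂ refl)))

scheme⇒peirce : SchemeHolds Extra → PeirceHolds Extra
scheme⇒peirce scheme A B = mp ⊢-refl (scheme A B A)

theorem1 : {ℓ : Level} (Extra : Formula → Set ℓ) →
    ((PeirceHolds Extra → SchemeHolds Extra) × (SchemeHolds Extra → PeirceHolds Extra))
theorem1 _ = peirce⇒scheme , scheme⇒peirce
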